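{- For every integer $n\geqslant 0$, $S_1(n)$ is even unless $n$ is twice a generalized pentagonal number, i.e. unless $n = j(3j-1)$ for some $j\in\mathbb{Z}$.
   Context: For a partition $\lambda$, the least gap $g_1(\lambda)$ is the smallest positive integer that does not occur as a part of $\lambda$. $S_1(n)=\sum_{\lambda\vdash n} g_1(\lambda)$ is the sum of the least gaps over all partitions of $n$. Generalized pentagonal numbers are the numbers $j(3j-1)/2$, $j\in\mathbb{Z}$. -}

module Defs where

open import Data.Nat using (ℕ; zero; suc; _+_; _≤?_; _≟_)
open import Data.List using (List; []; _∷_; _++_; map; length)
open import Data.Nat.ListAction using (sum)
open import Data.Bool using (Bool; true; false; if_then_else_)
open import Relation.Nullary.Decidable using (⌊_⌋)

-- A partition is represented as a weakly decreasing list of positive parts.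
-- partsBounded fuel m n : all partitions of n whose parts are all ≤ m
-- (listed with largest part first). 'fuel' is a structural recursion bound;
-- fuel = n suffices since each step removes a part ≥ 1.
partsBounded : ℕ → ℕ → ℕ → List (List ℕ)
partsBounded fuel    m zero    = [] ∷ []
partsBounded zero    m (suc n) = []
partsBounded (suc f) m (suc n) = go m
  where
  go : ℕ → List (List ℕ)
  go zero    = []
  go (suc p) =
    (if ⌊ suc p ≤? suc n ⌋
      then map (suc p ∷_) (partsBounded f (suc p) (suc n Data.Nat.∸ suc p))
      else [])
    ++ go p

partitions : ℕ → List (List ℕ)
partitions n = partsBounded n n n

elem : ℕ → List ℕ → Bool
elem k []       = false
elem k (x ∷ xs) = if ⌊ k ≟ x ⌋ then true else elem k xs

-- smallest k ≥ start not occurring in xs, searching at most 'fuel' steps;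
-- fuel = length xs + 1 suffices.
gapFrom : ℕ → ℕ → List ℕ → ℕ
gapFrom zero       start xs = start
gapFrom (suc fuel) start xs =
  if elem start xs then gapFrom fuel (suc start) xs else start

g₁ : List ℕ → ℕ
g₁ xs = gapFrom (suc (length xs)) 1 xs

S₁ : ℕ → ℕ
S₁ n = sum (map g₁ (partitions n))

{-# OPTIONS --safe #-}
-- Work mod 2. The least gap of λ is 1 + #{t ≥ 1 : 1, …, t are all parts of λ}, and removing one copy
-- of each of 1, …, t turns the partitions of n containing them into those of n − t(t+1)/2, so S₁(n) is
-- congruent to the coefficient of qⁿ in Σ_t q^(t(t+1)/2) / (q;q)_∞. With E_b = q^(b(b+1)/2)/(q;q)_b, a
-- telescoping argument around the Durfee-square identity shows that over 𝔽₂ this series is Σ_b E_b²,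
-- i.e. F(q²) for F = Σ_b E_b. By Euler F = (-q;q)_∞ ≡ (q;q)_∞, and a finite form of Shanks' identity
-- gives the pentagonal number theorem (q;q)_∞ ≡ Σ_j q^(j(3j−1)/2).
module Submission where

open import Defs
open import Data.Bool using (Bool; true; false; not; _∧_; _xor_; if_then_else_)
open import Data.Empty using (⊥-elim)
open import Data.Nat using (ℕ; zero; suc; _+_; _∸_; _≤_; _<_; z≤n; s≤s; _≤?_; _≟_)
open import Data.Nat.Divisibility using (_∣_; divides)
open import Data.Product using (∃; _×_; _,_; proj₁; proj₂)
open import Function using (_∘_; _∘′_)
open import Relation.Binary.PropositionalEquality
open import Relation.Nullary using (¬_)

-- A module keeps ℕ's _*_ apart from ℤ's, which the statement of corollary4 uses.
module _ where
  open import Data.Bool.Properties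
    using (xor-identityʳ; xor-same; xor-assoc; xor-comm; not-distribˡ-xor; not-distribʳ-xor; if-eta;
           ∧-zeroʳ; ∧-identityʳ; ∧-idem; ∧-comm; ∧-distribˡ-xor; ∧-distribʳ-xor)
  open import Data.Bool.Solver using (module xor-∧-Solver)
  open import Data.Integer using (ℤ; +_; -_; _-_) renaming (_+_ to _+ℤ_; _*_ to _*ℤ_)
  open import Data.Integer.Properties using (pos-*)
  import Data.Integer.Tactic.RingSolver as ℤ-Solver
  open import Data.List using (List; []; _∷_; _++_; map; length)
  open import Data.List.Relation.Unary.All as All using (All; []; _∷_)
  open import Data.List.Relation.Unary.All.Properties using (++⁺; map⁺)
  open import Data.Nat using (_*_; _≤′_; ≤′-refl; ≤′-step; ⌊_/2⌋)
  open import Data.Nat.ListAction using (sum)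
  open import Data.Nat.Properties
  open import Data.Nat.Tactic.RingSolver using (solve-∀)
  open import Data.Sum using (_⊎_; inj₁; inj₂)
  open import Relation.Binary.Definitions using (tri<; tri≈; tri>)
  open import Relation.Nullary.Decidable using (⌊_⌋; yes; no)
  import Relation.Binary.Reasoning.Setoid as SetoidReasoning
  open xor-∧-Solver using (solve; _:+_; _:=_)

  -- Sums in 𝔽₂

  ⨁ : ℕ → (ℕ → Bool) → Bool
  ⨁ zero    h = false
  ⨁ (suc n) h = ⨁ n h xor h n

  ⨁-cong : ∀ n {h k : ℕ → Bool} → (∀ i → i < n → h i ≡ k i) → ⨁ n h ≡ ⨁ n k
  ⨁-cong zero    eq = refl
  ⨁-cong (suc n) eq = cong₂ _xor_ (⨁-cong n (λ i i<n → eq i (m≤n⇒m≤1+n i<n))) (eq n ≤-refl)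

  ⨁-false : ∀ n h → (∀ i → i < n → h i ≡ false) → ⨁ n h ≡ false
  ⨁-false n h eq = trans (⨁-cong n {k = λ _ → false} eq) (⨁-zero n)
    where
    ⨁-zero : ∀ n → ⨁ n (λ _ → false) ≡ false
    ⨁-zero zero    = refl
    ⨁-zero (suc n) = cong (_xor false) (⨁-zero n)

  ⨁-cons : ∀ n h → ⨁ (suc n) h ≡ h 0 xor ⨁ n (h ∘ suc)
  ⨁-cons zero    h = sym (xor-identityʳ (h 0))
  ⨁-cons (suc n) h = begin
    (⨁ n h xor h n) xor h (suc n)               ≡⟨ cong (_xor h (suc n)) (⨁-cons n h) ⟩
    (h 0 xor ⨁ n (h ∘ suc)) xor h (suc n)       ≡⟨ solve 3 (λ a s b → (a :+ s) :+ b := a :+ (s :+ b)) refl (h 0) _ _ ⟩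
    h 0 xor (⨁ n (h ∘ suc) xor h (suc n))       ∎
    where open ≡-Reasoning

  ⨁-xor : ∀ n h k → ⨁ n (λ i → h i xor k i) ≡ ⨁ n h xor ⨁ n k
  ⨁-xor zero    h k = refl
  ⨁-xor (suc n) h k = trans (cong (_xor (h n xor k n)) (⨁-xor n h k))
    (solve 4 (λ a b c d → (a :+ b) :+ (c :+ d) := (a :+ c) :+ (b :+ d)) refl (⨁ n h) (⨁ n k) (h n) (k n))

  ⨁-extend : ∀ {n m} h → n ≤ m → (∀ i → n ≤ i → h i ≡ false) → ⨁ m h ≡ ⨁ n h
  ⨁-extend {n} h n≤m tail = go (≤⇒≤′ n≤m)
    where
    go : ∀ {m} → n ≤′ m → ⨁ m h ≡ ⨁ n h
    go ≤′-refl            = refl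
    go (≤′-step {m} n≤′m) = trans (cong₂ _xor_ (go n≤′m) (tail m (≤′⇒≤ n≤′m))) (xor-identityʳ _)

  ⨁-telescope : ∀ n (v : ℕ → Bool) → ⨁ n (λ i → v i xor v (suc i)) ≡ v 0 xor v n
  ⨁-telescope zero    v = sym (xor-same (v 0))
  ⨁-telescope (suc n) v = trans (cong (_xor (v n xor v (suc n))) (⨁-telescope n v))
    (solve 3 (λ a b c → (a :+ b) :+ (b :+ c) := a :+ c) refl (v 0) (v n) (v (suc n)))

  ⨁-vanishing-tails : ∀ a b h → (∀ i → a ≤ i → h i ≡ false) → (∀ i → b ≤ i → h i ≡ false) →
                      ⨁ a h ≡ ⨁ b h
  ⨁-vanishing-tails a b h tail-a tail-b with ≤-total a b
  ... | inj₁ a≤b = sym (⨁-extend h a≤b tail-a)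
  ... | inj₂ b≤a = ⨁-extend h b≤a tail-b

  odd : ℕ → Bool
  odd zero          = false
  odd (suc zero)    = true
  odd (suc (suc n)) = odd n

  odd-suc : ∀ n → odd (suc n) ≡ not (odd n)
  odd-suc zero          = refl
  odd-suc (suc zero)    = refl
  odd-suc (suc (suc n)) = odd-suc n

  odd-+ : ∀ m n → odd (m + n) ≡ odd m xor odd n
  odd-+ zero          n = refl
  odd-+ (suc zero)    n = odd-suc n
  odd-+ (suc (suc m)) n = odd-+ m n

  even⇒⌊n/2⌋+⌊n/2⌋≡n : ∀ n → odd n ≡ false → ⌊ n /2⌋ + ⌊ n /2⌋ ≡ n
  even⇒⌊n/2⌋+⌊n/2⌋≡n zero          _    = refl
  even⇒⌊n/2⌋+⌊n/2⌋≡n (suc (suc n)) even =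
    cong suc (trans (+-suc ⌊ n /2⌋ ⌊ n /2⌋) (cong suc (even⇒⌊n/2⌋+⌊n/2⌋≡n n even)))

  unless-cong : ∀ b {x y} → (b ≡ false → x ≡ y) → (if b then false else x) ≡ (if b then false else y)
  unless-cong true  _   = refl
  unless-cong false x≡y = x≡y refl

  unless-true : ∀ b {x} → (if b then false else x) ≡ true → b ≡ false × x ≡ true
  unless-true true  ()
  unless-true false x≡true = refl , x≡true

  ⨁-palindrome : ∀ m h → (∀ i j → i + j ≡ m → h i ≡ h j) →
                 ⨁ (suc m) h ≡ (if odd m then false else h ⌊ m /2⌋)
  ⨁-palindrome zero          h sym-h = refl
  ⨁-palindrome (suc zero)    h sym-h = trans (cong (_xor h 1) (sym-h 0 1 refl)) (xor-same (h 1))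
  ⨁-palindrome (suc (suc m)) h sym-h = begin
    ⨁ (3 + m) h                                     ≡⟨ ⨁-cons (2 + m) h ⟩
    h 0 xor (⨁ (suc m) (h ∘ suc) xor h (2 + m))
      ≡⟨ cong (_xor (⨁ (suc m) (h ∘ suc) xor h (2 + m))) (sym-h 0 (2 + m) refl) ⟩
    h (2 + m) xor (⨁ (suc m) (h ∘ suc) xor h (2 + m)) ≡⟨ solve 2 (λ a s → a :+ (s :+ a) := s) refl (h (2 + m)) _ ⟩
    ⨁ (suc m) (h ∘ suc)                             ≡⟨ ⨁-palindrome m (h ∘ suc) sym-h∘suc ⟩
    (if odd m then false else h (suc ⌊ m /2⌋))      ∎
    where
    open ≡-Reasoning
    sym-h∘suc : ∀ i j → i + j ≡ m → h (suc i) ≡ h (suc j)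
    sym-h∘suc i j i+j≡m = sym-h (suc i) (suc j) (cong suc (trans (+-suc i j) (cong suc i+j≡m)))

  -- Power series over 𝔽₂

  Series : Set
  Series = ℕ → Bool

  module ≗-Reasoning = SetoidReasoning (ℕ →-setoid Bool)

  infixl 6 _⊕_
  _⊕_ : Series → Series → Series
  (f ⊕ g) m = f m xor g m

  ⊕-cong : ∀ {f f′ g g′} → f ≗ f′ → g ≗ g′ → f ⊕ g ≗ f′ ⊕ g′
  ⊕-cong f≗f′ g≗g′ m = cong₂ _xor_ (f≗f′ m) (g≗g′ m)

  ⊕-congˡ : ∀ f {g g′} → g ≗ g′ → f ⊕ g ≗ f ⊕ g′
  ⊕-congˡ f g≗g′ m = cong (f m xor_) (g≗g′ m)

  ⊕-congʳ : ∀ g {f f′} → f ≗ f′ → f ⊕ g ≗ f′ ⊕ g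
  ⊕-congʳ g f≗f′ m = cong (_xor g m) (f≗f′ m)

  one : Series
  one zero    = true
  one (suc _) = false

  shift₁ : Series → Series
  shift₁ f zero    = false
  shift₁ f (suc m) = f m

  -- shift a f is q^a · f
  shift : ℕ → Series → Series
  shift zero    f = f
  shift (suc a) f = shift₁ (shift a f)

  shift₁-cong : ∀ {f g} → f ≗ g → shift₁ f ≗ shift₁ g
  shift₁-cong f≗g zero    = refl
  shift₁-cong f≗g (suc m) = f≗g m

  shift-cong : ∀ a {f g} → f ≗ g → shift a f ≗ shift a g
  shift-cong zero    f≗g = f≗g
  shift-cong (suc a) f≗g = shift₁-cong (shift-cong a f≗g)

  shift-⊕ : ∀ a f g → shift a (f ⊕ g) ≗ shift a f ⊕ shift a g
  shift-⊕ zero    f g m       = refl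
  shift-⊕ (suc a) f g zero    = refl
  shift-⊕ (suc a) f g (suc m) = shift-⊕ a f g m

  shift-+ : ∀ a b f → shift a (shift b f) ≗ shift (a + b) f
  shift-+ zero    b f m = refl
  shift-+ (suc a) b f   = shift₁-cong (shift-+ a b f)

  shift-≡ : ∀ {a b} f → a ≡ b → shift a f ≗ shift b f
  shift-≡ f refl m = refl

  shift-+-apply : ∀ a f m → shift a f (a + m) ≡ f m
  shift-+-apply zero    f m = refl
  shift-+-apply (suc a) f m = shift-+-apply a f m

  shift-≤-apply : ∀ {a m} f → a ≤ m → shift a f m ≡ f (m ∸ a)
  shift-≤-apply {zero}              f z≤n       = refl
  shift-≤-apply {suc a} {suc m}     f (s≤s a≤m) = shift-≤-apply f a≤m

  VanishesBelow : ℕ → Series → Set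
  VanishesBelow o f = ∀ m → m < o → f m ≡ false

  vanishesBelow-≤ : ∀ {o o′ f} → o′ ≤ o → VanishesBelow o f → VanishesBelow o′ f
  vanishesBelow-≤ o′≤o van m m<o′ = van m (≤-trans m<o′ o′≤o)

  shift-vanishesBelow : ∀ a {o} f → VanishesBelow o f → VanishesBelow (a + o) (shift a f)
  shift-vanishesBelow zero    f van = van
  shift-vanishesBelow (suc a) f van zero    _         = refl
  shift-vanishesBelow (suc a) f van (suc m) (s≤s m<) = shift-vanishesBelow a f van m m<

  shift-< : ∀ a f → VanishesBelow a (shift a f)
  shift-< a f m m<a = shift-vanishesBelow a f (λ _ ()) m (≤-trans m<a (≤-reflexive (sym (+-identityʳ a))))

  shift-apply : ∀ a f m → shift a f m ≡ (if ⌊ a ≤? m ⌋ then f (m ∸ a) else false)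
  shift-apply a f m with a ≤? m
  ... | yes a≤m = shift-≤-apply f a≤m
  ... | no  a≰m = shift-< a f m (≰⇒> a≰m)

  ⊕-vanishesBelow : ∀ {o f g} → VanishesBelow o f → VanishesBelow o g → VanishesBelow o (f ⊕ g)
  ⊕-vanishesBelow van-f van-g m m<o = cong₂ _xor_ (van-f m m<o) (van-g m m<o)

  AgreeUpTo : ℕ → Series → Series → Set
  AgreeUpTo n f g = ∀ m → m ≤ n → f m ≡ g m

  shift-agreeUpTo : ∀ n a {f g} → AgreeUpTo n f g → AgreeUpTo n (shift a f) (shift a g)
  shift-agreeUpTo n zero    agree = agree
  shift-agreeUpTo n (suc a) agree zero    _  = refl
  shift-agreeUpTo n (suc a) agree (suc m) m< = shift-agreeUpTo n a agree m (≤-trans (n≤1+n m) m<)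

  infixl 7 _⋆_
  _⋆_ : Series → Series → Series
  (f ⋆ g) m = ⨁ (suc m) (λ i → f i ∧ g (m ∸ i))

  ⋆-congˡ : ∀ f {g g′} → g ≗ g′ → f ⋆ g ≗ f ⋆ g′
  ⋆-congˡ f g≗g′ m = ⨁-cong (suc m) (λ i _ → cong (f i ∧_) (g≗g′ (m ∸ i)))

  ⋆-congʳ : ∀ g {f f′} → f ≗ f′ → f ⋆ g ≗ f′ ⋆ g
  ⋆-congʳ g f≗f′ m = ⨁-cong (suc m) (λ i _ → cong (_∧ g (m ∸ i)) (f≗f′ i))

  ⋆-distribʳ-⊕ : ∀ f g h → (f ⊕ g) ⋆ h ≗ f ⋆ h ⊕ g ⋆ h
  ⋆-distribʳ-⊕ f g h m =
    trans (⨁-cong (suc m) (λ i _ → ∧-distribʳ-xor (h (m ∸ i)) (f i) (g i))) (⨁-xor (suc m) _ _)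

  ⋆-distribˡ-⊕ : ∀ f g h → f ⋆ (g ⊕ h) ≗ f ⋆ g ⊕ f ⋆ h
  ⋆-distribˡ-⊕ f g h m =
    trans (⨁-cong (suc m) (λ i _ → ∧-distribˡ-xor (f i) (g (m ∸ i)) (h (m ∸ i)))) (⨁-xor (suc m) _ _)

  shift₁-⋆ : ∀ f g → shift₁ f ⋆ g ≗ shift₁ (f ⋆ g)
  shift₁-⋆ f g zero    = refl
  shift₁-⋆ f g (suc m) = ⨁-cons (suc m) (λ i → shift₁ f i ∧ g (suc m ∸ i))

  ⋆-shift₁ : ∀ f g → f ⋆ shift₁ g ≗ shift₁ (f ⋆ g)
  ⋆-shift₁ f g zero    = ∧-zeroʳ (f 0)
  ⋆-shift₁ f g (suc m) = begin
    ⨁ (suc m) (λ i → f i ∧ shift₁ g (suc m ∸ i)) xor (f (suc m) ∧ shift₁ g (m ∸ m))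
      ≡⟨ cong₂ _xor_ (⨁-cong (suc m) (λ i i≤m → cong (λ k → f i ∧ shift₁ g k) (+-∸-assoc 1 (≤-pred i≤m))))
                     (cong (λ k → f (suc m) ∧ shift₁ g k) (n∸n≡0 m)) ⟩
    ⨁ (suc m) (λ i → f i ∧ g (m ∸ i)) xor (f (suc m) ∧ false)
      ≡⟨ cong (⨁ (suc m) (λ i → f i ∧ g (m ∸ i)) xor_) (∧-zeroʳ (f (suc m))) ⟩
    ⨁ (suc m) (λ i → f i ∧ g (m ∸ i)) xor false
      ≡⟨ xor-identityʳ _ ⟩
    (f ⋆ g) m ∎
    where open ≡-Reasoning

  shift-⋆ : ∀ a f g → shift a f ⋆ g ≗ shift a (f ⋆ g)
  shift-⋆ zero    f g m = refl
  shift-⋆ (suc a) f g m = trans (shift₁-⋆ (shift a f) g m) (shift₁-cong (shift-⋆ a f g) m)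

  ⋆-shift : ∀ a f g → f ⋆ shift a g ≗ shift a (f ⋆ g)
  ⋆-shift zero    f g m = refl
  ⋆-shift (suc a) f g m = trans (⋆-shift₁ f (shift a g) m) (shift₁-cong (⋆-shift a f g) m)

  ⋆-vanishesBelow : ∀ {o} f g → VanishesBelow o f → VanishesBelow o (f ⋆ g)
  ⋆-vanishesBelow f g van m m<o =
    ⨁-false (suc m) _ (λ i i≤m → cong (_∧ g (m ∸ i)) (van i (≤-<-trans (≤-pred i≤m) m<o)))

  ⋆-identityʳ : ∀ f → f ⋆ one ≗ f
  ⋆-identityʳ f m = begin
    ⨁ m (λ i → f i ∧ one (m ∸ i)) xor (f m ∧ one (m ∸ m))
      ≡⟨ cong₂ _xor_ (⨁-false m _ (λ i i<m → trans (cong (f i ∧_) (one-∸ i<m)) (∧-zeroʳ (f i))))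
                     (cong (λ k → f m ∧ one k) (n∸n≡0 m)) ⟩
    f m ∧ true ≡⟨ ∧-identityʳ (f m) ⟩
    f m ∎
    where
    open ≡-Reasoning
    one-∸ : ∀ {i m} → i < m → one (m ∸ i) ≡ false
    one-∸ {zero}  {suc m} _         = refl
    one-∸ {suc i} {suc m} (s≤s i<m) = one-∸ i<m

  -- dilate f is f(q²)
  dilate : Series → Series
  dilate f m = if odd m then false else f ⌊ m /2⌋

  -- Frobenius: the cross terms f i ∧ f j and f j ∧ f i cancel, and f i ∧ f i = f i.
  ⋆-self : ∀ f → f ⋆ f ≗ dilate f
  ⋆-self f m = trans (⨁-palindrome m (λ i → f i ∧ f (m ∸ i)) symmetric)
    (unless-cong (odd m) (λ even → trans (cong (λ k → f ⌊ m /2⌋ ∧ f k) (half even)) (∧-idem (f ⌊ m /2⌋))))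
    where
    symmetric : ∀ i j → i + j ≡ m → f i ∧ f (m ∸ i) ≡ f j ∧ f (m ∸ j)
    symmetric i j i+j≡m = subst (λ k → f i ∧ f (k ∸ i) ≡ f j ∧ f (k ∸ j)) i+j≡m
      (trans (cong (λ k → f i ∧ f k) (m+n∸m≡n i j))
      (trans (∧-comm (f i) (f j)) (cong (λ k → f j ∧ f k) (sym (m+n∸n≡m i j)))))
    half : odd m ≡ false → m ∸ ⌊ m /2⌋ ≡ ⌊ m /2⌋
    half even = trans (cong (_∸ ⌊ m /2⌋) (sym (even⇒⌊n/2⌋+⌊n/2⌋≡n m even))) (m+n∸m≡n ⌊ m /2⌋ ⌊ m /2⌋)

  Summable : (ℕ → Series) → Set
  Summable F = ∀ b → VanishesBelow b (F b)

  -- Only the terms b ≤ m are read at q^m, which gives the true sum exactly when F is Summable.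
  ∑ : (ℕ → Series) → Series
  ∑ F m = ⨁ (suc m) (λ b → F b m)

  ∑-cong : ∀ {F G} → (∀ b → F b ≗ G b) → ∑ F ≗ ∑ G
  ∑-cong F≗G m = ⨁-cong (suc m) (λ b _ → F≗G b m)

  ∑-⊕ : ∀ F G → ∑ (λ b → F b ⊕ G b) ≗ ∑ F ⊕ ∑ G
  ∑-⊕ F G m = ⨁-xor (suc m) _ _

  ∑-cons : ∀ F → Summable F → ∑ F ≗ F 0 ⊕ ∑ (F ∘ suc)
  ∑-cons F summable m = begin
    ∑ F m                                        ≡⟨ ⨁-cons m (λ b → F b m) ⟩
    F 0 m xor ⨁ m (λ b → F (suc b) m)           ≡⟨ cong (F 0 m xor_) (sym (xor-identityʳ _)) ⟩
    F 0 m xor (⨁ m (λ b → F (suc b) m) xor false)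
      ≡⟨ cong (λ x → F 0 m xor (⨁ m (λ b → F (suc b) m) xor x)) (sym (summable (suc m) m ≤-refl)) ⟩
    F 0 m xor ∑ (F ∘ suc) m                      ∎
    where open ≡-Reasoning

  ∑-head : ∀ F m → (∀ b → F (suc b) m ≡ false) → ∑ F m ≡ F 0 m
  ∑-head F m tail = trans (⨁-cons m (λ b → F b m))
    (trans (cong (F 0 m xor_) (⨁-false m _ (λ b _ → tail b))) (xor-identityʳ _))

  ∑-telescope : ∀ V → Summable V → ∑ (λ b → V b ⊕ V (suc b)) ≗ V 0
  ∑-telescope V summable m = trans (⨁-telescope (suc m) (λ b → V b m))
    (trans (cong (V 0 m xor_) (summable (suc m) m ≤-refl)) (xor-identityʳ _))

  ∑-vanishesBelow : ∀ {o} F → (∀ b → VanishesBelow o (F b)) → VanishesBelow o (∑ F)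
  ∑-vanishesBelow F van m m<o = ⨁-false (suc m) _ (λ b _ → van b m m<o)

  shift-summable : ∀ a F → Summable F → Summable (λ b → shift a (F b))
  shift-summable a F summable b =
    vanishesBelow-≤ (m≤n+m b a) (shift-vanishesBelow a (F b) (summable b))

  ∑-shift : ∀ a F → Summable F → ∑ (λ b → shift a (F b)) ≗ shift a (∑ F)
  ∑-shift zero    F summable m       = refl
  ∑-shift (suc a) F summable zero    = refl
  ∑-shift (suc a) F summable (suc m) = begin
    ⨁ (suc m) (λ b → shift a (F b) m) xor shift a (F (suc m)) m
      ≡⟨ cong (⨁ (suc m) (λ b → shift a (F b) m) xor_) (shift-summable a F summable (suc m) m ≤-refl) ⟩
    ⨁ (suc m) (λ b → shift a (F b) m) xor false
      ≡⟨ xor-identityʳ _ ⟩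
    ∑ (λ b → shift a (F b)) m
      ≡⟨ ∑-shift a F summable m ⟩
    shift a (∑ F) m ∎
    where open ≡-Reasoning

  ∑-dilate : ∀ F → Summable F → ∑ (λ b → dilate (F b)) ≗ dilate (∑ F)
  ∑-dilate F summable m with odd m
  ... | true  = ⨁-false (suc m) _ (λ _ _ → refl)
  ... | false = ⨁-extend (λ b → F b ⌊ m /2⌋) (s≤s (⌊n/2⌋≤n m)) (λ b b> → summable b ⌊ m /2⌋ b>)

  -- Partitions with bounded parts

  pParity : ℕ → ℕ → ℕ → Bool
  pParity fuel    m       zero    = true
  pParity zero    m       (suc n) = false
  pParity (suc f) zero    (suc n) = false
  pParity (suc f) (suc m) (suc n) =
    pParity (suc f) m (suc n) xor
    (if ⌊ suc m ≤? suc n ⌋ then pParity f (suc m) (suc n ∸ suc m) else false)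

  pParity-fuel-suc : ∀ f m n → n ≤ f → pParity (suc f) m n ≡ pParity f m n
  pParity-fuel-suc f       m       zero    _   = refl
  pParity-fuel-suc zero    m       (suc n) ()
  pParity-fuel-suc (suc f) zero    (suc n) _   = refl
  pParity-fuel-suc (suc f) (suc m) (suc n) n≤f = cong₂ _xor_ (pParity-fuel-suc (suc f) m (suc n) n≤f)
    (cong (λ x → if ⌊ suc m ≤? suc n ⌋ then x else false)
          (pParity-fuel-suc f (suc m) (n ∸ m) (≤-trans (m∸n≤m n m) (≤-pred n≤f))))

  pParity-fuel : ∀ {f} m n → n ≤ f → pParity f m n ≡ pParity n m n
  pParity-fuel m n n≤f = go (≤⇒≤′ n≤f)
    where
    go : ∀ {f} → n ≤′ f → pParity f m n ≡ pParity n m n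
    go ≤′-refl            = refl
    go (≤′-step {f} n≤′f) = trans (pParity-fuel-suc f m n (≤′⇒≤ n≤′f)) (go n≤′f)

  -- P m is 1/(q;q)_m mod 2: its coefficients count partitions with parts ≤ m, as partsBounded lists them.
  P : ℕ → Series
  P m n = pParity n m n

  P∞ : Series
  P∞ n = P n n

  P-zero : P 0 ≗ one
  P-zero zero    = refl
  P-zero (suc n) = refl

  P-suc : ∀ m → P (suc m) ≗ P m ⊕ shift (suc m) (P (suc m))
  P-suc m zero    = refl
  P-suc m (suc n) with suc m ≤? suc n
  ... | yes m<n = cong (P m (suc n) xor_)
    (trans (pParity-fuel (suc m) (n ∸ m) (m∸n≤m n m)) (sym (shift-≤-apply (P (suc m)) m<n)))
  ... | no  m≮n = cong (P m (suc n) xor_) (sym (shift-< (suc m) (P (suc m)) (suc n) (≰⇒> m≮n)))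

  P-suc-agree : ∀ m → AgreeUpTo m (P (suc m)) (P m)
  P-suc-agree m n n≤m = trans (P-suc m n)
    (trans (cong (P m n xor_) (shift-< (suc m) (P (suc m)) n (s≤s n≤m))) (xor-identityʳ _))

  P-agree-P∞ : ∀ {m} n → n ≤ m → P m n ≡ P∞ n
  P-agree-P∞ n n≤m = go (≤⇒≤′ n≤m)
    where
    go : ∀ {m} → n ≤′ m → P m n ≡ P∞ n
    go ≤′-refl            = refl
    go (≤′-step {m} n≤′m) = trans (P-suc-agree m n (≤′⇒≤ n≤′m)) (go n≤′m)

  shift-P-suc-apply : ∀ a m k →
    shift a (P (suc m)) k ≡ shift a (P m) k xor (if ⌊ suc m ≤? k ⌋ then shift a (P (suc m)) (k ∸ suc m) else false)
  shift-P-suc-apply a m k = begin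
    shift a (P (suc m)) k                                            ≡⟨ shift-cong a (P-suc m) k ⟩
    shift a (P m ⊕ shift (suc m) (P (suc m))) k                      ≡⟨ shift-⊕ a (P m) _ k ⟩
    shift a (P m) k xor shift a (shift (suc m) (P (suc m))) k        ≡⟨ cong (shift a (P m) k xor_) shifts-commute ⟩
    shift a (P m) k xor shift (suc m) (shift a (P (suc m))) k        ≡⟨ cong (shift a (P m) k xor_) (shift-apply (suc m) _ k) ⟩
    shift a (P m) k xor (if ⌊ suc m ≤? k ⌋ then shift a (P (suc m)) (k ∸ suc m) else false) ∎
    where
    open ≡-Reasoning
    shifts-commute : shift a (shift (suc m) (P (suc m))) k ≡ shift (suc m) (shift a (P (suc m))) k
    shifts-commute = trans (shift-+ a (suc m) _ k)
      (trans (shift-≡ (P (suc m)) (+-comm a (suc m)) k) (sym (shift-+ (suc m) a _ k)))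

  -- A Durfee-square identity

  tri : ℕ → ℕ
  tri zero    = zero
  tri (suc k) = suc k + tri k

  n≤tri : ∀ k → k ≤ tri k
  n≤tri zero    = z≤n
  n≤tri (suc k) = m≤m+n (suc k) (tri k)

  tri-mono-≤ : ∀ {a b} → a ≤ b → tri a ≤ tri b
  tri-mono-≤ z≤n       = z≤n
  tri-mono-≤ (s≤s a≤b) = +-mono-≤ (s≤s a≤b) (tri-mono-≤ a≤b)

  -- E b = q^(b(b+1)/2)/(q;q)_b and E′ b = q^(b(b-1)/2)/(q;q)_b, so that E b ⋆ E′ b = q^(b²)/(q;q)_b².
  E : ℕ → Series
  E b = shift (tri b) (P b)

  E′ : ℕ → Series
  E′ zero    = P 0
  E′ (suc b) = shift (tri b) (P (suc b))

  E-vanishesBelow : ∀ {o} b → o ≤ tri b → VanishesBelow o (E b)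
  E-vanishesBelow b o≤tri = vanishesBelow-≤ o≤tri (shift-< (tri b) (P b))

  E-summable : Summable E
  E-summable b = E-vanishesBelow b (n≤tri b)

  E+-vanishesBelow : ∀ b k → VanishesBelow b (E (b + k))
  E+-vanishesBelow b k = E-vanishesBelow (b + k) (≤-trans (m≤m+n b k) (n≤tri (b + k)))

  E′-suc : ∀ b → E′ (suc b) ≗ E b ⊕ E (suc b)
  E′-suc b = begin
    shift (tri b) (P (suc b))                                        ≈⟨ shift-cong (tri b) (P-suc b) ⟩
    shift (tri b) (P b ⊕ shift (suc b) (P (suc b)))                  ≈⟨ shift-⊕ (tri b) _ _ ⟩
    E b ⊕ shift (tri b) (shift (suc b) (P (suc b)))                  ≈⟨ ⊕-congˡ (E b) (shift-+ (tri b) (suc b) _) ⟩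
    E b ⊕ shift (tri b + suc b) (P (suc b))                          ≈⟨ ⊕-congˡ (E b) (shift-≡ _ (+-comm (tri b) (suc b))) ⟩
    E b ⊕ E (suc b)                                                  ∎
    where open ≗-Reasoning

  E-split : ∀ b → E b ≗ E′ (suc b) ⊕ E (suc b)
  E-split b m = trans (solve 2 (λ x y → x := (x :+ y) :+ y) refl (E b m) (E (suc b) m))
                      (cong (_xor E (suc b) m) (sym (E′-suc b m)))

  shift-E′ : ∀ b → shift b (E′ b) ≗ E b
  shift-E′ zero    m = refl
  shift-E′ (suc b)   = shift-+ (suc b) (tri b) (P (suc b))

  E-suc : ∀ a → E (suc a) ≗ shift (suc a) (E a ⊕ E (suc a))
  E-suc a m = trans (sym (shift-E′ (suc a) m)) (shift-cong (suc a) (E′-suc a) m)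

  mixedSum : ℕ → Series
  mixedSum k = ∑ (λ b → E (b + k) ⋆ E′ b)

  squareSum : ℕ → Series
  squareSum k = ∑ (λ b → E (b + k) ⋆ E b)

  mixed-summable : ∀ k → Summable (λ b → E (b + k) ⋆ E′ b)
  mixed-summable k b = ⋆-vanishesBelow (E (b + k)) (E′ b) (E+-vanishesBelow b k)

  square-summable : ∀ k → Summable (λ b → E (b + k) ⋆ E b)
  square-summable k b = ⋆-vanishesBelow (E (b + k)) (E b) (E+-vanishesBelow b k)

  mixedTerm-suc : ∀ k b → E (b + suc k) ⋆ E′ b ≗
    shift (suc k) (E (b + k) ⋆ E b ⊕ (E (suc b + k) ⋆ E′ (suc b) ⊕ E (suc b + k) ⋆ E (suc b)))
  mixedTerm-suc k b = begin
    E (b + suc k) ⋆ E′ b                                 ≈⟨ ⋆-congʳ (E′ b) (λ m → cong (λ c → E c m) (+-suc b k)) ⟩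
    E (suc (b + k)) ⋆ E′ b                               ≈⟨ ⋆-congʳ (E′ b) (E-suc (b + k)) ⟩
    shift (suc (b + k)) (E (b + k) ⊕ E (suc b + k)) ⋆ E′ b ≈⟨ shift-⋆ (suc (b + k)) (E (b + k) ⊕ E (suc b + k)) (E′ b) ⟩
    shift (suc (b + k)) ((E (b + k) ⊕ E (suc b + k)) ⋆ E′ b) ≈⟨ shift-≡ ((E (b + k) ⊕ E (suc b + k)) ⋆ E′ b) (cong suc (+-comm b k)) ⟩
    shift (suc k + b) ((E (b + k) ⊕ E (suc b + k)) ⋆ E′ b) ≈⟨ shift-+ (suc k) b ((E (b + k) ⊕ E (suc b + k)) ⋆ E′ b) ⟨
    shift (suc k) (shift b ((E (b + k) ⊕ E (suc b + k)) ⋆ E′ b))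
      ≈⟨ shift-cong (suc k) (⋆-shift b (E (b + k) ⊕ E (suc b + k)) (E′ b)) ⟨
    shift (suc k) ((E (b + k) ⊕ E (suc b + k)) ⋆ shift b (E′ b))
      ≈⟨ shift-cong (suc k) (⋆-congˡ (E (b + k) ⊕ E (suc b + k)) (shift-E′ b)) ⟩
    shift (suc k) ((E (b + k) ⊕ E (suc b + k)) ⋆ E b)
      ≈⟨ shift-cong (suc k) (⋆-distribʳ-⊕ (E (b + k)) (E (suc b + k)) (E b)) ⟩
    shift (suc k) (E (b + k) ⋆ E b ⊕ E (suc b + k) ⋆ E b)
      ≈⟨ shift-cong (suc k) (⊕-congˡ (E (b + k) ⋆ E b) (⋆-congˡ (E (suc b + k)) (E-split b))) ⟩
    shift (suc k) (E (b + k) ⋆ E b ⊕ E (suc b + k) ⋆ (E′ (suc b) ⊕ E (suc b)))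
      ≈⟨ shift-cong (suc k) (⊕-congˡ (E (b + k) ⋆ E b) (⋆-distribˡ-⊕ (E (suc b + k)) (E′ (suc b)) (E (suc b)))) ⟩
    shift (suc k) (E (b + k) ⋆ E b ⊕ (E (suc b + k) ⋆ E′ (suc b) ⊕ E (suc b + k) ⋆ E (suc b))) ∎
    where open ≗-Reasoning

  -- Summing mixedTerm-suc over b, the squares telescope away and the mixed terms give back mixedSum k.
  mixedSum-suc : ∀ k → mixedSum (suc k) ≗ shift (suc k) (mixedSum k)
  mixedSum-suc k = begin
    mixedSum (suc k)                    ≈⟨ ∑-cong (mixedTerm-suc k) ⟩
    ∑ (λ b → shift (suc k) (Y b))       ≈⟨ ∑-shift (suc k) Y Y-summable ⟩
    shift (suc k) (∑ Y)                 ≈⟨ shift-cong (suc k) ∑Y ⟩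
    shift (suc k) (mixedSum k)          ∎
    where
    open ≗-Reasoning
    V : ℕ → Series
    V b = E (b + k) ⋆ E b
    G : ℕ → Series
    G b = E (b + k) ⋆ E′ b
    Y : ℕ → Series
    Y b = V b ⊕ (G (suc b) ⊕ V (suc b))
    Y-summable : Summable Y
    Y-summable b = ⊕-vanishesBelow (square-summable k b)
      (⊕-vanishesBelow (vanishesBelow-≤ (n≤1+n b) (mixed-summable k (suc b)))
                       (vanishesBelow-≤ (n≤1+n b) (square-summable k (suc b))))
    ∑Y : ∑ Y ≗ mixedSum k
    ∑Y = begin
      ∑ Y                                         ≈⟨ ∑-cong (λ b m → solve 3 (λ v g w → v :+ (g :+ w) := (v :+ w) :+ g) refl (V b m) _ _) ⟩
      ∑ (λ b → (V b ⊕ V (suc b)) ⊕ G (suc b))     ≈⟨ ∑-⊕ (λ b → V b ⊕ V (suc b)) (G ∘ suc) ⟩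
      ∑ (λ b → V b ⊕ V (suc b)) ⊕ ∑ (G ∘ suc)     ≈⟨ ⊕-congʳ (∑ (G ∘ suc)) (∑-telescope V (square-summable k)) ⟩
      G 0 ⊕ ∑ (G ∘ suc)                           ≈⟨ ∑-cons G (mixed-summable k) ⟨
      mixedSum k                                  ∎

  mixedSum≗shift-tri : ∀ k → mixedSum k ≗ shift (tri k) (mixedSum 0)
  mixedSum≗shift-tri zero    m = refl
  mixedSum≗shift-tri (suc k) m = trans (mixedSum-suc k m)
    (trans (shift-cong (suc k) (mixedSum≗shift-tri k) m) (shift-+ (suc k) (tri k) (mixedSum 0) m))

  -- The Durfee-square identity Σ_b q^(b²)/(q;q)_b² = 1/(q;q)_∞ (mod 2). Read at q^(tri m + m), the
  -- identity mixedSum m = q^(tri m) · mixedSum 0 isolates the b = 0 term of mixedSum m, which is E m ⋆ 1.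
  mixedSum-zero : mixedSum 0 ≗ P∞
  mixedSum-zero m = begin
    mixedSum 0 m                              ≡⟨ shift-+-apply (tri m) (mixedSum 0) m ⟨
    shift (tri m) (mixedSum 0) (tri m + m)    ≡⟨ mixedSum≗shift-tri m (tri m + m) ⟨
    mixedSum m (tri m + m)                    ≡⟨ ∑-head (λ b → E (b + m) ⋆ E′ b) (tri m + m) later ⟩
    (E m ⋆ P 0) (tri m + m)                   ≡⟨ ⋆-congˡ (E m) P-zero (tri m + m) ⟩
    (E m ⋆ one) (tri m + m)                   ≡⟨ ⋆-identityʳ (E m) (tri m + m) ⟩
    E m (tri m + m)                           ≡⟨ shift-+-apply (tri m) (P m) m ⟩
    P∞ m                                      ∎
    where
    open ≡-Reasoning
    bound : ∀ b → suc (tri m + m) ≤ tri (suc b + m)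
    bound b = ≤-trans (≤-reflexive (cong suc (+-comm (tri m) m))) (tri-mono-≤ (s≤s (m≤n+m m b)))
    later : ∀ b → (E (suc b + m) ⋆ E′ (suc b)) (tri m + m) ≡ false
    later b = ⋆-vanishesBelow (E (suc b + m)) (E′ (suc b))
                (E-vanishesBelow (suc b + m) (bound b)) (tri m + m) ≤-refl

  mixedSum≗squareSum⊕squareSum : ∀ k → mixedSum k ≗ squareSum k ⊕ squareSum (suc k)
  mixedSum≗squareSum⊕squareSum k = begin
    mixedSum k                                      ≈⟨ ∑-cons G (mixed-summable k) ⟩
    G 0 ⊕ ∑ (G ∘ suc)                               ≈⟨ ⊕-congˡ (G 0) (∑-cong G-suc) ⟩
    G 0 ⊕ ∑ (λ b → V (suc k) b ⊕ V k (suc b))       ≈⟨ ⊕-congˡ (G 0) (∑-⊕ (V (suc k)) (V k ∘ suc)) ⟩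
    G 0 ⊕ (squareSum (suc k) ⊕ ∑ (V k ∘ suc))       ≈⟨ (λ m → solve 3 (λ a s t → a :+ (s :+ t) := (a :+ t) :+ s) refl (G 0 m) _ _) ⟩
    (V k 0 ⊕ ∑ (V k ∘ suc)) ⊕ squareSum (suc k)     ≈⟨ ⊕-congʳ (squareSum (suc k)) (∑-cons (V k) (square-summable k)) ⟨
    squareSum k ⊕ squareSum (suc k)                 ∎
    where
    open ≗-Reasoning
    G : ℕ → Series
    G b = E (b + k) ⋆ E′ b
    V : ℕ → ℕ → Series
    V j b = E (b + j) ⋆ E b
    G-suc : ∀ b → G (suc b) ≗ V (suc k) b ⊕ V k (suc b)
    G-suc b = begin
      E (suc b + k) ⋆ E′ (suc b)                      ≈⟨ ⋆-congˡ (E (suc b + k)) (E′-suc b) ⟩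
      E (suc b + k) ⋆ (E b ⊕ E (suc b))               ≈⟨ ⋆-distribˡ-⊕ (E (suc b + k)) (E b) (E (suc b)) ⟩
      E (suc b + k) ⋆ E b ⊕ V k (suc b)
        ≈⟨ ⊕-congʳ (V k (suc b)) (⋆-congʳ (E b) (λ m → cong (λ c → E c m) (sym (+-suc b k)))) ⟩
      V (suc k) b ⊕ V k (suc b)                       ∎

  squareSum-vanishesBelow : ∀ k → VanishesBelow (tri k) (squareSum k)
  squareSum-vanishesBelow k = ∑-vanishesBelow (λ b → E (b + k) ⋆ E b)
    (λ b → ⋆-vanishesBelow (E (b + k)) (E b) (E-vanishesBelow (b + k) (tri-mono-≤ (m≤n+m k b))))

  -- The left side is the coefficient of qⁿ in P∞ · Σ_k q^(tri k); it equals that of Σ_b (E b)² = (Σ_b E b)(q²).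
  ⨁-shift-tri-P∞ : ∀ n → ⨁ (suc n) (λ k → shift (tri k) P∞ n) ≡ dilate (∑ E) n
  ⨁-shift-tri-P∞ n = begin
    ⨁ (suc n) (λ k → shift (tri k) P∞ n)
      ≡⟨ ⨁-cong (suc n) (λ k _ → trans (shift-cong (tri k) (λ m → sym (mixedSum-zero m)) n)
                                  (trans (sym (mixedSum≗shift-tri k n)) (mixedSum≗squareSum⊕squareSum k n))) ⟩
    ⨁ (suc n) (λ k → squareSum k n xor squareSum (suc k) n)
      ≡⟨ ⨁-telescope (suc n) (λ k → squareSum k n) ⟩
    squareSum 0 n xor squareSum (suc n) n
      ≡⟨ cong (squareSum 0 n xor_) (squareSum-vanishesBelow (suc n) n (≤-trans (n<1+n n) (n≤tri (suc n)))) ⟩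
    squareSum 0 n xor false
      ≡⟨ xor-identityʳ _ ⟩
    squareSum 0 n
      ≡⟨ ∑-cong (λ b m → trans (⋆-congʳ (E b) (λ m → cong (λ c → E c m) (+-identityʳ b)) m) (⋆-self (E b) m)) n ⟩
    ∑ (dilate ∘ E) n
      ≡⟨ ∑-dilate E E-summable n ⟩
    dilate (∑ E) n ∎
    where open ≡-Reasoning

  -- Euler's identity and Shanks' identity

  times1+q^ : ℕ → Series → Series
  times1+q^ i f = f ⊕ shift i f

  times1+q^-cong : ∀ i {f g} → f ≗ g → times1+q^ i f ≗ times1+q^ i g
  times1+q^-cong i f≗g = ⊕-cong f≗g (shift-cong i f≗g)

  times1+q^-≡ : ∀ {i j} f → i ≡ j → times1+q^ i f ≗ times1+q^ j f
  times1+q^-≡ f refl m = refl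

  prod1+q^ : ℕ → ℕ → Series → Series
  prod1+q^ lo zero      f = f
  prod1+q^ lo (suc len) f = times1+q^ lo (prod1+q^ (suc lo) len f)

  prod1+q^-cong : ∀ lo len {f g} → f ≗ g → prod1+q^ lo len f ≗ prod1+q^ lo len g
  prod1+q^-cong lo zero      f≗g = f≗g
  prod1+q^-cong lo (suc len) f≗g = times1+q^-cong lo (prod1+q^-cong (suc lo) len f≗g)

  prod1+q^-agreeUpTo : ∀ n lo len {f g} → AgreeUpTo n f g → AgreeUpTo n (prod1+q^ lo len f) (prod1+q^ lo len g)
  prod1+q^-agreeUpTo n lo zero      agree = agree
  prod1+q^-agreeUpTo n lo (suc len) agree m m≤n =
    cong₂ _xor_ (prod1+q^-agreeUpTo n (suc lo) len agree m m≤n)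
                (shift-agreeUpTo n lo (prod1+q^-agreeUpTo n (suc lo) len agree) m m≤n)

  prod1+q^-length : ∀ lo {l l′} f → l ≡ l′ → prod1+q^ lo l f ≗ prod1+q^ lo l′ f
  prod1+q^-length lo f refl m = refl

  times1+q^-comm : ∀ a b f → times1+q^ a (times1+q^ b f) ≗ times1+q^ b (times1+q^ a f)
  times1+q^-comm a b f m = begin
    (f m xor shift b f m) xor shift a (f ⊕ shift b f) m
      ≡⟨ cong ((f m xor shift b f m) xor_) (shift-⊕ a f (shift b f) m) ⟩
    (f m xor shift b f m) xor (shift a f m xor shift a (shift b f) m)
      ≡⟨ cong (λ x → (f m xor shift b f m) xor (shift a f m xor x)) shift-shift ⟩
    (f m xor shift b f m) xor (shift a f m xor shift b (shift a f) m)
      ≡⟨ solve 4 (λ x y z w → (x :+ y) :+ (z :+ w) := (x :+ z) :+ (y :+ w)) refl (f m) _ _ _ ⟩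
    (f m xor shift a f m) xor (shift b f m xor shift b (shift a f) m)
      ≡⟨ cong ((f m xor shift a f m) xor_) (shift-⊕ b f (shift a f) m) ⟨
    times1+q^ b (times1+q^ a f) m ∎
    where
    open ≡-Reasoning
    shift-shift : shift a (shift b f) m ≡ shift b (shift a f) m
    shift-shift = trans (shift-+ a b f m) (trans (shift-≡ f (+-comm a b) m) (sym (shift-+ b a f m)))

  prod1+q^-last : ∀ lo len f → prod1+q^ lo (suc len) f ≗ times1+q^ (lo + len) (prod1+q^ lo len f)
  prod1+q^-last lo zero      f = times1+q^-≡ f (sym (+-identityʳ lo))
  prod1+q^-last lo (suc len) f = begin
    times1+q^ lo (prod1+q^ (suc lo) (suc len) f)
      ≈⟨ times1+q^-cong lo (prod1+q^-last (suc lo) len f) ⟩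
    times1+q^ lo (times1+q^ (suc lo + len) (prod1+q^ (suc lo) len f))
      ≈⟨ times1+q^-comm lo (suc lo + len) (prod1+q^ (suc lo) len f) ⟩
    times1+q^ (suc lo + len) (prod1+q^ lo (suc len) f)
      ≈⟨ times1+q^-≡ (prod1+q^ lo (suc len) f) (sym (+-suc lo len)) ⟩
    times1+q^ (lo + suc len) (prod1+q^ lo (suc len) f) ∎
    where open ≗-Reasoning

  -- eulerTail j = Σ_a q^(j a) E a, which is (1 + q^(j+1))(1 + q^(j+2))⋯
  eulerTail : ℕ → Series
  eulerTail j = ∑ (λ a → shift (j * a) (E a))

  eulerTail-summable : ∀ j → Summable (λ a → shift (j * a) (E a))
  eulerTail-summable j a =
    vanishesBelow-≤ (≤-trans (n≤tri a) (m≤n+m (tri a) (j * a))) (shift-vanishesBelow (j * a) (E a) (shift-< (tri a) (P a)))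

  eulerTail-term-suc : ∀ j a → shift (j * suc a) (E (suc a)) ≗
    shift (suc j) (shift (suc j * a) (E a)) ⊕ shift (suc j * suc a) (E (suc a))
  eulerTail-term-suc j a = begin
    shift (j * suc a) (E (suc a))                              ≈⟨ shift-cong (j * suc a) (E-suc a) ⟩
    shift (j * suc a) (shift (suc a) (E a ⊕ E (suc a)))        ≈⟨ shift-+ (j * suc a) (suc a) (E a ⊕ E (suc a)) ⟩
    shift (j * suc a + suc a) (E a ⊕ E (suc a))                ≈⟨ shift-⊕ (j * suc a + suc a) (E a) (E (suc a)) ⟩
    shift (j * suc a + suc a) (E a) ⊕ shift (j * suc a + suc a) (E (suc a))
      ≈⟨ ⊕-cong (shift-≡ (E a) (exponent₁ j a)) (shift-≡ (E (suc a)) (exponent₂ j a)) ⟩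
    shift (suc j + suc j * a) (E a) ⊕ shift (suc j * suc a) (E (suc a))
      ≈⟨ ⊕-congʳ (shift (suc j * suc a) (E (suc a))) (shift-+ (suc j) (suc j * a) (E a)) ⟨
    shift (suc j) (shift (suc j * a) (E a)) ⊕ shift (suc j * suc a) (E (suc a)) ∎
    where
    open ≗-Reasoning
    exponent₁ : ∀ j a → j * suc a + suc a ≡ suc j + suc j * a
    exponent₁ = solve-∀
    exponent₂ : ∀ j a → j * suc a + suc a ≡ suc j * suc a
    exponent₂ = solve-∀

  eulerTail-suc : ∀ j → eulerTail j ≗ times1+q^ (suc j) (eulerTail (suc j))
  eulerTail-suc j = begin
    eulerTail j                                          ≈⟨ ∑-cons (F j) (eulerTail-summable j) ⟩
    F j 0 ⊕ ∑ (F j ∘ suc)                                ≈⟨ ⊕-congˡ (F j 0) (∑-cong (eulerTail-term-suc j)) ⟩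
    F j 0 ⊕ ∑ (λ a → shift (suc j) (F (suc j) a) ⊕ F (suc j) (suc a))
      ≈⟨ ⊕-congˡ (F j 0) (∑-⊕ (λ a → shift (suc j) (F (suc j) a)) (F (suc j) ∘ suc)) ⟩
    F j 0 ⊕ (∑ (λ a → shift (suc j) (F (suc j) a)) ⊕ ∑ (F (suc j) ∘ suc))
      ≈⟨ ⊕-congˡ (F j 0) (⊕-congʳ (∑ (F (suc j) ∘ suc)) (∑-shift (suc j) (F (suc j)) (eulerTail-summable (suc j)))) ⟩
    F j 0 ⊕ (shift (suc j) (eulerTail (suc j)) ⊕ ∑ (F (suc j) ∘ suc))
      ≈⟨ (λ m → solve 3 (λ a s r → a :+ (s :+ r) := (a :+ r) :+ s) refl (F j 0 m) _ _) ⟩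
    (F (suc j) 0 ⊕ ∑ (F (suc j) ∘ suc)) ⊕ shift (suc j) (eulerTail (suc j))
      ≈⟨ ⊕-congʳ (shift (suc j) (eulerTail (suc j))) (∑-cons (F (suc j)) (eulerTail-summable (suc j))) ⟨
    times1+q^ (suc j) (eulerTail (suc j)) ∎
    where
    open ≗-Reasoning
    F : ℕ → ℕ → Series
    F j a = shift (j * a) (E a)

  eulerTail≗prod : ∀ len j → eulerTail j ≗ prod1+q^ (suc j) len (eulerTail (j + len))
  eulerTail≗prod zero      j m = cong (λ i → eulerTail i m) (sym (+-identityʳ j))
  eulerTail≗prod (suc len) j = begin
    eulerTail j                                               ≈⟨ eulerTail-suc j ⟩
    times1+q^ (suc j) (eulerTail (suc j))                     ≈⟨ times1+q^-cong (suc j) (eulerTail≗prod len (suc j)) ⟩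
    prod1+q^ (suc j) (suc len) (eulerTail (suc j + len))
      ≈⟨ prod1+q^-cong (suc j) (suc len) (λ m → cong (λ i → eulerTail i m) (sym (+-suc j len))) ⟩
    prod1+q^ (suc j) (suc len) (eulerTail (j + suc len))      ∎
    where open ≗-Reasoning

  eulerTail-agreeUpTo-one : ∀ n → AgreeUpTo n (eulerTail n) one
  eulerTail-agreeUpTo-one n m m≤n =
    trans (∑-head (λ a → shift (n * a) (E a)) m later) (trans (cong (λ e → shift e (E 0) m) (*-zeroʳ n)) (P-zero m))
    where
    later : ∀ a → shift (n * suc a) (E (suc a)) m ≡ false
    later a = shift-vanishesBelow (n * suc a) (E (suc a)) (E-vanishesBelow (suc a) (s≤s z≤n)) m
      (≤-<-trans (≤-trans m≤n (m≤m*n n (suc a))) (m<m+n (n * suc a) (s≤s z≤n)))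

  ∑E≡prod : ∀ n → ∑ E n ≡ prod1+q^ 1 n one n
  ∑E≡prod n = trans (eulerTail≗prod n 0 n) (prod1+q^-agreeUpTo n 1 n (eulerTail-agreeUpTo-one n) n ≤-refl)

  -- pent⁺ n and pent⁻ n are the pentagonal numbers j(3j-1)/2 for j = n+1 and j = -(n+1).
  pent⁺ : ℕ → ℕ
  pent⁺ n = suc n + n + (n * n + tri n)

  pent⁻ : ℕ → ℕ
  pent⁻ n = suc n * suc n + tri (suc n)

  pentagonalSum : ℕ → Series
  pentagonalSum zero    = one
  pentagonalSum (suc n) = pentagonalSum n ⊕ shift (pent⁺ n) one ⊕ shift (pent⁻ n) one

  partialProd : ℕ → ℕ → Series
  partialProd n k = prod1+q^ (suc k) (n ∸ k) one

  shanksTerm : ℕ → ℕ → Series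
  shanksTerm n k = shift (n * k + tri k) (partialProd n k)

  shanksSum : ℕ → Series
  shanksSum n m = ⨁ (suc n) (λ k → shanksTerm n k m)

  partialProd-self : ∀ n → partialProd n n ≗ one
  partialProd-self n = prod1+q^-length (suc n) one (n∸n≡0 n)

  partialProd-suc : ∀ n k → k ≤ n → partialProd (suc n) k ≗ times1+q^ (suc n) (partialProd n k)
  partialProd-suc n k k≤n = begin
    prod1+q^ (suc k) (suc n ∸ k) one                ≈⟨ prod1+q^-length (suc k) one (+-∸-assoc 1 k≤n) ⟩
    prod1+q^ (suc k) (suc (n ∸ k)) one              ≈⟨ prod1+q^-last (suc k) (n ∸ k) one ⟩
    times1+q^ (suc k + (n ∸ k)) (partialProd n k)   ≈⟨ times1+q^-≡ (partialProd n k) (cong suc (m+[n∸m]≡n k≤n)) ⟩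
    times1+q^ (suc n) (partialProd n k)             ∎
    where open ≗-Reasoning

  partialProd-< : ∀ n k → k < n → partialProd n k ≗ times1+q^ (suc k) (partialProd n (suc k))
  partialProd-< n k k<n = prod1+q^-length (suc k) one (+-∸-assoc 1 k<n)

  shanksTerm-suc : ∀ n k → k ≤ n →
    shanksTerm (suc n) k ≗ shift k (shanksTerm n k) ⊕ shift (suc n + k) (shanksTerm n k)
  shanksTerm-suc n k k≤n = begin
    shift (suc n * k + tri k) (partialProd (suc n) k)
      ≈⟨ shift-cong (suc n * k + tri k) (partialProd-suc n k k≤n) ⟩
    shift (suc n * k + tri k) (times1+q^ (suc n) (partialProd n k))
      ≈⟨ shift-⊕ (suc n * k + tri k) (partialProd n k) (shift (suc n) (partialProd n k)) ⟩
    shift (suc n * k + tri k) (partialProd n k) ⊕ shift (suc n * k + tri k) (shift (suc n) (partialProd n k))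
      ≈⟨ ⊕-cong (shift-≡ (partialProd n k) (+-assoc k (n * k) (tri k)))
                (λ m → trans (shift-+ (suc n * k + tri k) (suc n) (partialProd n k) m)
                             (shift-≡ (partialProd n k) (exponent n k (tri k)) m)) ⟩
    shift (k + (n * k + tri k)) (partialProd n k) ⊕ shift (suc n + k + (n * k + tri k)) (partialProd n k)
      ≈⟨ ⊕-cong (shift-+ k (n * k + tri k) (partialProd n k)) (shift-+ (suc n + k) (n * k + tri k) (partialProd n k)) ⟨
    shift k (shanksTerm n k) ⊕ shift (suc n + k) (shanksTerm n k) ∎
    where
    open ≗-Reasoning
    exponent : ∀ n k x → suc n * k + x + suc n ≡ suc n + k + (n * k + x)
    exponent = solve-∀

  shanksTerm-top : ∀ n → shanksTerm (suc n) (suc n) ≗ shift (pent⁻ n) one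
  shanksTerm-top n = shift-cong (pent⁻ n) (partialProd-self (suc n))

  shift-shanksTerm-< : ∀ n k → k < n →
    shift (suc n + k) (shanksTerm n k) ≗ shanksTerm n (suc k) ⊕ shift (suc k) (shanksTerm n (suc k))
  shift-shanksTerm-< n k k<n = begin
    shift (suc n + k) (shanksTerm n k)
      ≈⟨ shift-+ (suc n + k) (n * k + tri k) (partialProd n k) ⟩
    shift e (partialProd n k)
      ≈⟨ shift-cong e (partialProd-< n k k<n) ⟩
    shift e (times1+q^ (suc k) (partialProd n (suc k)))
      ≈⟨ shift-⊕ e (partialProd n (suc k)) (shift (suc k) (partialProd n (suc k))) ⟩
    shift e (partialProd n (suc k)) ⊕ shift e (shift (suc k) (partialProd n (suc k)))
      ≈⟨ ⊕-cong (shift-≡ (partialProd n (suc k)) (exponent₁ n k (tri k)))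
                (λ m → trans (shift-+ e (suc k) (partialProd n (suc k)) m)
                       (trans (shift-≡ (partialProd n (suc k)) (exponent₂ n k (tri k)) m)
                              (sym (shift-+ (suc k) (n * suc k + tri (suc k)) (partialProd n (suc k)) m)))) ⟩
    shanksTerm n (suc k) ⊕ shift (suc k) (shanksTerm n (suc k)) ∎
    where
    open ≗-Reasoning
    e : ℕ
    e = suc n + k + (n * k + tri k)
    exponent₁ : ∀ n k x → suc n + k + (n * k + x) ≡ n * suc k + (suc k + x)
    exponent₁ = solve-∀
    exponent₂ : ∀ n k x → suc n + k + (n * k + x) + suc k ≡ suc k + (n * suc k + (suc k + x))
    exponent₂ = solve-∀

  shift-shanksTerm-self : ∀ n → shift (suc n + n) (shanksTerm n n) ≗ shift (pent⁺ n) one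
  shift-shanksTerm-self n m =
    trans (shift-+ (suc n + n) (n * n + tri n) (partialProd n n) m) (shift-cong (pent⁺ n) (partialProd-self n) m)

  -- A finite form of Shanks' identity, reduced mod 2.
  shanksSum≗pentagonalSum : ∀ n → shanksSum n ≗ pentagonalSum n
  shanksSum≗pentagonalSum zero    m = refl
  shanksSum≗pentagonalSum (suc n) m = begin
    shanksSum (suc n) m
      ≡⟨ cong (_xor shanksTerm (suc n) (suc n) m) (⨁-cong (suc n) (λ k k≤n → shanksTerm-suc n k (≤-pred k≤n) m)) ⟩
    ⨁ (suc n) (λ k → X k xor Y k) xor shanksTerm (suc n) (suc n) m
      ≡⟨ cong₂ _xor_ (⨁-xor (suc n) X Y) (shanksTerm-top n m) ⟩
    (⨁ (suc n) X xor (⨁ n Y xor Y n)) xor Q⁻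
      ≡⟨ cong (λ x → (x xor (⨁ n Y xor Y n)) xor Q⁻) (⨁-cons n X) ⟩
    ((A 0 xor ⨁ n (X ∘ suc)) xor (⨁ n Y xor Y n)) xor Q⁻
      ≡⟨ cong (λ x → ((A 0 xor ⨁ n (X ∘ suc)) xor (x xor Y n)) xor Q⁻)
              (trans (⨁-cong n (λ k k<n → shift-shanksTerm-< n k k<n m)) (⨁-xor n (A ∘ suc) (X ∘ suc))) ⟩
    ((A 0 xor ⨁ n (X ∘ suc)) xor ((⨁ n (A ∘ suc) xor ⨁ n (X ∘ suc)) xor Y n)) xor Q⁻
      ≡⟨ cong (λ x → ((A 0 xor ⨁ n (X ∘ suc)) xor ((⨁ n (A ∘ suc) xor ⨁ n (X ∘ suc)) xor x)) xor Q⁻)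
              (shift-shanksTerm-self n m) ⟩
    ((A 0 xor ⨁ n (X ∘ suc)) xor ((⨁ n (A ∘ suc) xor ⨁ n (X ∘ suc)) xor Q⁺)) xor Q⁻
      ≡⟨ cong (_xor Q⁻) (solve 4 (λ a x s e → (a :+ x) :+ ((s :+ x) :+ e) := (a :+ s) :+ e) refl (A 0) _ _ Q⁺) ⟩
    ((A 0 xor ⨁ n (A ∘ suc)) xor Q⁺) xor Q⁻
      ≡⟨ cong (λ x → (x xor Q⁺) xor Q⁻) (sym (⨁-cons n A)) ⟩
    (shanksSum n m xor Q⁺) xor Q⁻
      ≡⟨ cong (λ x → (x xor Q⁺) xor Q⁻) (shanksSum≗pentagonalSum n m) ⟩
    pentagonalSum (suc n) m ∎
    where
    open ≡-Reasoning
    A X Y : ℕ → Bool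
    A k = shanksTerm n k m
    X k = shift k (shanksTerm n k) m
    Y k = shift (suc n + k) (shanksTerm n k) m
    Q⁺ Q⁻ : Bool
    Q⁺ = shift (pent⁺ n) one m
    Q⁻ = shift (pent⁻ n) one m

  shift-one : ∀ e m → shift e one m ≡ true → m ≡ e
  shift-one zero    zero    _ = refl
  shift-one zero    (suc m) ()
  shift-one (suc e) zero    ()
  shift-one (suc e) (suc m) q = cong suc (shift-one e m q)

  pentagonalSum-support : ∀ n m → pentagonalSum n m ≡ true → m ≡ 0 ⊎ ∃ λ i → m ≡ pent⁺ i ⊎ m ≡ pent⁻ i
  pentagonalSum-support zero    zero    _ = inj₁ refl
  pentagonalSum-support zero    (suc m) ()
  pentagonalSum-support (suc n) m q with pentagonalSum n m in q₀ | shift (pent⁺ n) one m in q⁺ | shift (pent⁻ n) one m in q⁻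
  ... | true  | _     | _    = pentagonalSum-support n m q₀
  ... | false | true  | _    = inj₂ (n , inj₁ (shift-one (pent⁺ n) m q⁺))
  ... | false | false | true = inj₂ (n , inj₂ (shift-one (pent⁻ n) m q⁻))
  pentagonalSum-support (suc n) m () | false | false | false

  partialProd-zero-agreeUpTo : ∀ n → AgreeUpTo n (partialProd n 0) (shanksSum n)
  partialProd-zero-agreeUpTo n m m≤n = sym (trans (⨁-cons n (λ k → shanksTerm n k m))
    (trans (cong (shanksTerm n 0 m xor_) (⨁-false n _ (λ k _ → later k)))
           (trans (xor-identityʳ _) (shift-≡ (partialProd n 0) (trans (+-identityʳ (n * 0)) (*-zeroʳ n)) m))))
    where
    later : ∀ k → shanksTerm n (suc k) m ≡ false
    later k = shift-< (n * suc k + tri (suc k)) (partialProd n (suc k)) m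
      (≤-<-trans (≤-trans m≤n (m≤m*n n (suc k))) (m<m+n (n * suc k) (s≤s z≤n)))

  -- Euler's theorem Σ_b q^(b(b+1)/2)/(q;q)_b = (-q;q)_∞ and the pentagonal number theorem, mod 2.
  ∑E≡pentagonalSum : ∀ n → ∑ E n ≡ pentagonalSum n n
  ∑E≡pentagonalSum n =
    trans (∑E≡prod n) (trans (partialProd-zero-agreeUpTo n n ≤-refl) (shanksSum≗pentagonalSum n n))

  -- Least gaps

  ⨁ₗ : {A : Set} → List A → (A → Bool) → Bool
  ⨁ₗ []       w = false
  ⨁ₗ (x ∷ xs) w = w x xor ⨁ₗ xs w

  ⨁ₗ-++ : {A : Set} (xs ys : List A) (w : A → Bool) → ⨁ₗ (xs ++ ys) w ≡ ⨁ₗ xs w xor ⨁ₗ ys w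
  ⨁ₗ-++ []       ys w = refl
  ⨁ₗ-++ (x ∷ xs) ys w = trans (cong (w x xor_) (⨁ₗ-++ xs ys w)) (sym (xor-assoc (w x) _ _))

  ⨁ₗ-map : {A B : Set} (f : A → B) (xs : List A) (w : B → Bool) → ⨁ₗ (map f xs) w ≡ ⨁ₗ xs (w ∘′ f)
  ⨁ₗ-map f []       w = refl
  ⨁ₗ-map f (x ∷ xs) w = cong (w (f x) xor_) (⨁ₗ-map f xs w)

  ⨁ₗ-cong : {A : Set} {Q : A → Set} (xs : List A) {w w′ : A → Bool} →
            All Q xs → (∀ {x} → Q x → w x ≡ w′ x) → ⨁ₗ xs w ≡ ⨁ₗ xs w′
  ⨁ₗ-cong []       []         w≡w′ = refl
  ⨁ₗ-cong (x ∷ xs) (qx ∷ qxs) w≡w′ = cong₂ _xor_ (w≡w′ qx) (⨁ₗ-cong xs qxs w≡w′)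

  ⨁ₗ-false : {A : Set} (xs : List A) → ⨁ₗ xs (λ _ → false) ≡ false
  ⨁ₗ-false []       = refl
  ⨁ₗ-false (x ∷ xs) = ⨁ₗ-false xs

  ⨁ₗ-if : {A : Set} (b : Bool) (xs : List A) (w : A → Bool) →
          ⨁ₗ (if b then xs else []) w ≡ (if b then ⨁ₗ xs w else false)
  ⨁ₗ-if true  xs w = refl
  ⨁ₗ-if false xs w = refl

  ⨁ₗ-⨁ : {A : Set} (xs : List A) (n : ℕ) (h : A → ℕ → Bool) →
         ⨁ₗ xs (λ x → ⨁ n (h x)) ≡ ⨁ n (λ i → ⨁ₗ xs (λ x → h x i))
  ⨁ₗ-⨁ []       n h = sym (⨁-false n _ (λ _ _ → refl))
  ⨁ₗ-⨁ (x ∷ xs) n h = trans (cong (⨁ n (h x) xor_) (⨁ₗ-⨁ xs n h)) (sym (⨁-xor n _ _))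

  odd-sum : {A : Set} (g : A → ℕ) (xs : List A) → odd (sum (map g xs)) ≡ ⨁ₗ xs (odd ∘′ g)
  odd-sum g []       = refl
  odd-sum g (x ∷ xs) = trans (odd-+ (g x) _) (cong (odd (g x) xor_) (odd-sum g xs))

  containsRun : ℕ → ℕ → List ℕ → Bool
  containsRun s zero    xs = true
  containsRun s (suc t) xs = elem s xs ∧ containsRun (suc s) t xs

  odd-gapFrom : ∀ f s xs → odd (gapFrom f s xs) ≡ odd s xor ⨁ f (λ t → containsRun s (suc t) xs)
  odd-gapFrom zero    s xs = sym (xor-identityʳ (odd s))
  odd-gapFrom (suc f) s xs with elem s xs in s∈xs
  ... | false = sym (trans (cong (odd s xor_) (⨁-false (suc f) _ (λ _ _ → refl))) (xor-identityʳ (odd s)))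
  ... | true  = begin
    odd (gapFrom f (suc s) xs)                            ≡⟨ odd-gapFrom f (suc s) xs ⟩
    odd (suc s) xor R                                     ≡⟨ cong (_xor R) (odd-suc s) ⟩
    not (odd s) xor R                                     ≡⟨ trans (sym (not-distribˡ-xor (odd s) R)) (not-distribʳ-xor (odd s) R) ⟩
    odd s xor (true xor R)                                ≡⟨ cong (odd s xor_) (⨁-cons f (λ t → containsRun (suc s) t xs)) ⟨
    odd s xor ⨁ (suc f) (λ t → containsRun (suc s) t xs)  ∎
    where
    open ≡-Reasoning
    R : Bool
    R = ⨁ f (λ t → containsRun (suc s) (suc t) xs)

  odd-g₁ : ∀ xs → odd (g₁ xs) ≡ ⨁ (2 + length xs) (λ t → containsRun 1 t xs)
  odd-g₁ xs = trans (odd-gapFrom (suc (length xs)) 1 xs) (sym (⨁-cons (suc (length xs)) (λ t → containsRun 1 t xs)))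

  remove : ℕ → List ℕ → List ℕ
  remove s []       = []
  remove s (x ∷ xs) = if ⌊ s ≟ x ⌋ then xs else x ∷ remove s xs

  elem-∷-≢ : ∀ {k x} xs → k ≢ x → elem k (x ∷ xs) ≡ elem k xs
  elem-∷-≢ {k} {x} xs k≢x with k ≟ x
  ... | yes k≡x = ⊥-elim (k≢x k≡x)
  ... | no  _   = refl

  elem-∷-≡ : ∀ k xs → elem k (k ∷ xs) ≡ true
  elem-∷-≡ k xs with k ≟ k
  ... | yes _   = refl
  ... | no  k≢k = ⊥-elim (k≢k refl)

  length-remove : ∀ s xs → elem s xs ≡ true → suc (length (remove s xs)) ≡ length xs
  length-remove s []       ()
  length-remove s (x ∷ xs) s∈xs with s ≟ x
  ... | yes _ = refl
  ... | no  _ = cong suc (length-remove s xs s∈xs)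

  elem-remove : ∀ {k s} xs → k ≢ s → elem k (remove s xs) ≡ elem k xs
  elem-remove []       k≢s = refl
  elem-remove {k} {s} (x ∷ xs) k≢s with s ≟ x
  ... | yes refl = sym (elem-∷-≢ xs k≢s)
  ... | no  _ with k ≟ x
  ...   | yes _ = refl
  ...   | no  _ = elem-remove xs k≢s

  containsRun-remove : ∀ {s a} t xs → s < a → containsRun a t (remove s xs) ≡ containsRun a t xs
  containsRun-remove zero    xs s<a = refl
  containsRun-remove (suc t) xs s<a =
    cong₂ _∧_ (elem-remove xs (λ a≡s → <-irrefl (sym a≡s) s<a)) (containsRun-remove t xs (m≤n⇒m≤1+n s<a))

  containsRun⇒≤length : ∀ s t xs → containsRun s t xs ≡ true → t ≤ length xs
  containsRun⇒≤length s zero    xs _   = z≤n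
  containsRun⇒≤length s (suc t) xs run with elem s xs in s∈xs
  containsRun⇒≤length s (suc t) xs () | false
  ... | true = ≤-trans (s≤s (containsRun⇒≤length (suc s) t (remove s xs)
                                (trans (containsRun-remove t xs ≤-refl) run)))
                       (≤-reflexive (length-remove s xs s∈xs))

  BoundedBy : ℕ → List ℕ → Set
  BoundedBy m = All (_≤ m)

  elem⇒≤ : ∀ {m v} xs → BoundedBy m xs → elem v xs ≡ true → v ≤ m
  elem⇒≤ []       []           ()
  elem⇒≤ {v = v} (x ∷ xs) (x≤m ∷ xs≤m) v∈ with v ≟ x
  ... | yes refl = x≤m
  ... | no  _    = elem⇒≤ xs xs≤m v∈

  containsRun⇒elem-last : ∀ s t xs → containsRun s (suc t) xs ≡ true → elem (s + t) xs ≡ true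
  containsRun⇒elem-last s t xs run with elem s xs in s∈xs | t
  containsRun⇒elem-last s t xs () | false | _
  ... | true | zero  = trans (cong (λ k → elem k xs) (+-identityʳ s)) s∈xs
  ... | true | suc t = trans (cong (λ k → elem k xs) (+-suc s t)) (containsRun⇒elem-last (suc s) t xs run)

  containsRun⇒≤bound : ∀ {m} t xs → BoundedBy m xs → containsRun 1 t xs ≡ true → t ≤ m
  containsRun⇒≤bound zero    xs _     _   = z≤n
  containsRun⇒≤bound (suc t) xs xs≤m run = elem⇒≤ xs xs≤m (containsRun⇒elem-last 1 t xs run)

  odd-g₁-bounded : ∀ {n} xs → BoundedBy n xs → odd (g₁ xs) ≡ ⨁ (suc n) (λ t → containsRun 1 t xs)
  odd-g₁-bounded {n} xs xs≤n = trans (odd-g₁ xs) (⨁-vanishing-tails _ _ _ beyond-length beyond-bound)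
    where
    beyond-length : ∀ t → 2 + length xs ≤ t → containsRun 1 t xs ≡ false
    beyond-length t t≥ with containsRun 1 t xs in run
    ... | false = refl
    ... | true  = ⊥-elim (<⇒≱ (≤-trans (n≤1+n (suc (length xs))) t≥) (containsRun⇒≤length 1 t xs run))
    beyond-bound : ∀ t → suc n ≤ t → containsRun 1 t xs ≡ false
    beyond-bound t t≥ with containsRun 1 t xs in run
    ... | false = refl
    ... | true  = ⊥-elim (<⇒≱ t≥ (containsRun⇒≤bound t xs xs≤n run))

  containsRun-∷-below : ∀ {s p} t μ → s + t ≤ p → containsRun s t (p ∷ μ) ≡ containsRun s t μ
  containsRun-∷-below zero    μ _ = refl
  containsRun-∷-below {s} {p} (suc t) μ s+t<p =
    cong₂ _∧_ (elem-∷-≢ μ (λ s≡p → <-irrefl s≡p (≤-trans (s≤s (m≤m+n s t)) s+t<p′)))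
              (containsRun-∷-below t μ s+t<p′)
    where
    s+t<p′ : suc s + t ≤ p
    s+t<p′ = ≤-trans (≤-reflexive (sym (+-suc s t))) s+t<p

  containsRun-∷-top : ∀ s t {p} μ → s + t ≡ p → containsRun s (suc t) (p ∷ μ) ≡ containsRun s t μ
  containsRun-∷-top s zero    μ refl =
    cong (_∧ true) (trans (cong (λ k → elem k (s + 0 ∷ μ)) (sym (+-identityʳ s))) (elem-∷-≡ (s + 0) μ))
  containsRun-∷-top s (suc t) μ refl =
    cong₂ _∧_ (elem-∷-≢ μ (λ s≡ → <-irrefl s≡ (≤-trans (s≤s (m≤m+n s t)) (≤-reflexive (sym (+-suc s t))))))
              (containsRun-∷-top (suc s) t μ (sym (+-suc s t)))

  containsRun-∷-above : ∀ {p} t μ → BoundedBy p μ → p < t → containsRun 1 t (p ∷ μ) ≡ false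
  containsRun-∷-above {p} t μ μ≤p p<t with containsRun 1 t (p ∷ μ) in run
  ... | false = refl
  ... | true  = ⊥-elim (<⇒≱ p<t (containsRun⇒≤bound t (p ∷ μ) (≤-refl ∷ μ≤p) run))

  partsBounded-bounded : ∀ f m n → All (BoundedBy m) (partsBounded f m n)
  partsBounded-bounded f       m       zero    = [] ∷ []
  partsBounded-bounded zero    m       (suc n) = []
  partsBounded-bounded (suc f) zero    (suc n) = []
  partsBounded-bounded (suc f) (suc m) (suc n) =
    ++⁺ heads (All.map (All.map (λ p≤m → m≤n⇒m≤1+n p≤m)) (partsBounded-bounded (suc f) m (suc n)))
    where
    heads : All (BoundedBy (suc m))
      (if ⌊ suc m ≤? suc n ⌋ then map (suc m ∷_) (partsBounded f (suc m) (n ∸ m)) else [])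
    heads with suc m ≤? suc n
    ... | yes _ = map⁺ (All.map (≤-refl ∷_) (partsBounded-bounded f (suc m) (n ∸ m)))
    ... | no  _ = []

  -- runCount≡runSeries: removing one copy of each of 1, …, t from a partition of n into parts ≤ m
  -- leaves an arbitrary partition of n − t(t+1)/2 into parts ≤ m (and there is none when m < t).
  runSeries : ℕ → ℕ → Series
  runSeries t m n = if ⌊ t ≤? m ⌋ then shift (tri t) (P m) n else false

  runSeries-≤ : ∀ {t m} n → t ≤ m → runSeries t m n ≡ shift (tri t) (P m) n
  runSeries-≤ {t} {m} n t≤m with t ≤? m
  ... | yes _   = refl
  ... | no  t≰m = ⊥-elim (t≰m t≤m)

  runSeries-> : ∀ {t m} n → m < t → runSeries t m n ≡ false
  runSeries-> {t} {m} n m<t with t ≤? m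
  ... | yes t≤m = ⊥-elim (<⇒≱ m<t t≤m)
  ... | no  _   = refl

  runSeries-suc-< : ∀ {t m} n → t < suc m →
    (if ⌊ suc m ≤? suc n ⌋ then runSeries t (suc m) (n ∸ m) else false) xor runSeries t m (suc n)
      ≡ runSeries t (suc m) (suc n)
  runSeries-suc-< {t} {m} n t<m = begin
    (if d then runSeries t (suc m) (n ∸ m) else false) xor runSeries t m (suc n)
      ≡⟨ cong₂ _xor_ (cong (λ x → if d then x else false) (runSeries-≤ (n ∸ m) t≤m)) (runSeries-≤ (suc n) (≤-pred t<m)) ⟩
    (if d then shift (tri t) (P (suc m)) (n ∸ m) else false) xor shift (tri t) (P m) (suc n)
      ≡⟨ xor-comm (if d then shift (tri t) (P (suc m)) (n ∸ m) else false) _ ⟩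
    shift (tri t) (P m) (suc n) xor (if d then shift (tri t) (P (suc m)) (n ∸ m) else false)
      ≡⟨ shift-P-suc-apply (tri t) m (suc n) ⟨
    shift (tri t) (P (suc m)) (suc n)
      ≡⟨ runSeries-≤ (suc n) t≤m ⟨
    runSeries t (suc m) (suc n) ∎
    where
    open ≡-Reasoning
    d : Bool
    d = ⌊ suc m ≤? suc n ⌋
    t≤m : t ≤ suc m
    t≤m = ≤-trans (n≤1+n t) t<m

  runSeries-suc-≡ : ∀ m n →
    (if ⌊ suc m ≤? suc n ⌋ then runSeries m (suc m) (n ∸ m) else false) xor runSeries (suc m) m (suc n)
      ≡ runSeries (suc m) (suc m) (suc n)
  runSeries-suc-≡ m n = begin
    (if d then runSeries m (suc m) (n ∸ m) else false) xor runSeries (suc m) m (suc n)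
      ≡⟨ cong₂ _xor_ (cong (λ x → if d then x else false) (runSeries-≤ (n ∸ m) (n≤1+n m)))
                     (runSeries-> {suc m} {m} (suc n) ≤-refl) ⟩
    (if d then shift (tri m) (P (suc m)) (n ∸ m) else false) xor false
      ≡⟨ xor-identityʳ _ ⟩
    (if d then shift (tri m) (P (suc m)) (n ∸ m) else false)
      ≡⟨ shift-apply (suc m) (shift (tri m) (P (suc m))) (suc n) ⟨
    shift (suc m) (shift (tri m) (P (suc m))) (suc n)
      ≡⟨ shift-+ (suc m) (tri m) (P (suc m)) (suc n) ⟩
    shift (tri (suc m)) (P (suc m)) (suc n)
      ≡⟨ runSeries-≤ {suc m} {suc m} (suc n) ≤-refl ⟨
    runSeries (suc m) (suc m) (suc n) ∎
    where
    open ≡-Reasoning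
    d : Bool
    d = ⌊ suc m ≤? suc n ⌋

  runCount : ℕ → ℕ → ℕ → ℕ → Bool
  runCount f t m n = ⨁ₗ (partsBounded f m n) (containsRun 1 t)

  runCount≡runSeries : ∀ f m n → n ≤ f → ∀ t → runCount f t m n ≡ runSeries t m n
  runCount≡runSeries f       m       zero    _ zero    = refl
  runCount≡runSeries f       m       zero    _ (suc t) = sym (if-eta ⌊ suc t ≤? m ⌋)
  runCount≡runSeries zero    m       (suc n) () t
  runCount≡runSeries (suc f) zero    (suc n) _ zero    = refl
  runCount≡runSeries (suc f) zero    (suc n) _ (suc t) = refl
  runCount≡runSeries (suc f) (suc m) (suc n) n≤f t = begin
    runCount (suc f) t (suc m) (suc n)
      ≡⟨ ⨁ₗ-++ (if d then map (suc m ∷_) L else []) (partsBounded (suc f) m (suc n)) (containsRun 1 t) ⟩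
    ⨁ₗ (if d then map (suc m ∷_) L else []) (containsRun 1 t) xor runCount (suc f) t m (suc n)
      ≡⟨ cong₂ _xor_ (⨁ₗ-if d (map (suc m ∷_) L) (containsRun 1 t)) (runCount≡runSeries (suc f) m (suc n) n≤f t) ⟩
    (if d then ⨁ₗ (map (suc m ∷_) L) (containsRun 1 t) else false) xor runSeries t m (suc n)
      ≡⟨ largest-part t ⟩
    runSeries t (suc m) (suc n) ∎
    where
    open ≡-Reasoning
    d : Bool
    d = ⌊ suc m ≤? suc n ⌋
    L : List (List ℕ)
    L = partsBounded f (suc m) (n ∸ m)
    if-d : ∀ {x y} → x ≡ y → (if d then x else false) ≡ (if d then y else false)
    if-d = cong (λ x → if d then x else false)
    tail : ∀ t → ⨁ₗ L (containsRun 1 t) ≡ runSeries t (suc m) (n ∸ m)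
    tail = runCount≡runSeries f (suc m) (n ∸ m) (≤-trans (m∸n≤m n m) (≤-pred n≤f))
    heads : ∀ t w → (∀ {μ} → BoundedBy (suc m) μ → containsRun 1 t (suc m ∷ μ) ≡ w μ) →
            ⨁ₗ (map (suc m ∷_) L) (containsRun 1 t) ≡ ⨁ₗ L w
    heads t w eq = trans (⨁ₗ-map (suc m ∷_) L (containsRun 1 t)) (⨁ₗ-cong L (partsBounded-bounded f (suc m) (n ∸ m)) eq)
    largest-part : ∀ t → (if d then ⨁ₗ (map (suc m ∷_) L) (containsRun 1 t) else false) xor runSeries t m (suc n)
                       ≡ runSeries t (suc m) (suc n)
    largest-part t with <-cmp t (suc m)
    ... | tri< t<m _ _ = trans
      (cong (_xor runSeries t m (suc n))
            (if-d (trans (heads t (containsRun 1 t) (λ _ → containsRun-∷-below t _ t<m)) (tail t))))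
      (runSeries-suc-< n t<m)
    ... | tri≈ _ refl _ = trans
      (cong (_xor runSeries (suc m) m (suc n))
            (if-d (trans (heads (suc m) (containsRun 1 m) (λ _ → containsRun-∷-top 1 m _ refl)) (tail m))))
      (runSeries-suc-≡ m n)
    ... | tri> _ _ m<t = begin
      (if d then ⨁ₗ (map (suc m ∷_) L) (containsRun 1 t) else false) xor runSeries t m (suc n)
        ≡⟨ cong₂ _xor_ (if-d (trans (heads t (λ _ → false) (λ μ≤m → containsRun-∷-above t _ μ≤m m<t)) (⨁ₗ-false L)))
                       (runSeries-> (suc n) (≤-trans (n≤1+n (suc m)) m<t)) ⟩
      (if d then false else false) xor false
        ≡⟨ cong (_xor false) (if-eta d) ⟩
      false
        ≡⟨ runSeries-> (suc n) m<t ⟨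
      runSeries t (suc m) (suc n) ∎

  -- The parity of S₁

  odd-S₁≡⨁ : ∀ n → odd (S₁ n) ≡ ⨁ (suc n) (λ t → shift (tri t) P∞ n)
  odd-S₁≡⨁ n = begin
    odd (S₁ n)                                                      ≡⟨ odd-sum g₁ (partitions n) ⟩
    ⨁ₗ (partitions n) (odd ∘′ g₁)                                    ≡⟨ ⨁ₗ-cong (partitions n) (partsBounded-bounded n n n) (λ {xs} → odd-g₁-bounded xs) ⟩
    ⨁ₗ (partitions n) (λ xs → ⨁ (suc n) (λ t → containsRun 1 t xs)) ≡⟨ ⨁ₗ-⨁ (partitions n) (suc n) (λ xs t → containsRun 1 t xs) ⟩
    ⨁ (suc n) (λ t → runCount n t n n)                              ≡⟨ ⨁-cong (suc n) (λ t t≤n → count t (≤-pred t≤n)) ⟩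
    ⨁ (suc n) (λ t → shift (tri t) P∞ n)                            ∎
    where
    open ≡-Reasoning
    count : ∀ t → t ≤ n → runCount n t n n ≡ shift (tri t) P∞ n
    count t t≤n = trans (runCount≡runSeries n n n ≤-refl t)
      (trans (runSeries-≤ n t≤n) (shift-agreeUpTo n (tri t) P-agree-P∞ n ≤-refl))

  odd-S₁≡pentagonalSum : ∀ n → odd (S₁ n) ≡ (if odd n then false else pentagonalSum ⌊ n /2⌋ ⌊ n /2⌋)
  odd-S₁≡pentagonalSum n = trans (odd-S₁≡⨁ n) (trans (⨁-shift-tri-P∞ n)
    (cong (λ x → if odd n then false else x) (∑E≡pentagonalSum ⌊ n /2⌋)))

  tri-double : ∀ i → tri i + tri i ≡ i * suc i
  tri-double zero    = refl
  tri-double (suc i) = trans (regroup i (tri i)) (trans (cong (λ x → suc i + suc i + x) (tri-double i)) (close i))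
    where
    regroup : ∀ i t → (suc i + t) + (suc i + t) ≡ suc i + suc i + (t + t)
    regroup = solve-∀
    close : ∀ i → suc i + suc i + i * suc i ≡ suc i * suc (suc i)
    close = solve-∀

  pent⁺-double : ∀ i → pent⁺ i + pent⁺ i ≡ suc i * (3 * i + 2)
  pent⁺-double i = trans (regroup i (tri i)) (trans (cong (λ x → 2 * (suc i + i + i * i) + x) (tri-double i)) (close i))
    where
    regroup : ∀ i t → (suc i + i + (i * i + t)) + (suc i + i + (i * i + t)) ≡ 2 * (suc i + i + i * i) + (t + t)
    regroup = solve-∀
    close : ∀ i → 2 * (suc i + i + i * i) + i * suc i ≡ suc i * (3 * i + 2)
    close = solve-∀

  pent⁻-double : ∀ i → pent⁻ i + pent⁻ i ≡ suc i * (3 * i + 4)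
  pent⁻-double i = trans (regroup i (tri (suc i))) (trans (cong (λ x → 2 * (suc i * suc i) + x) (tri-double (suc i))) (close i))
    where
    regroup : ∀ i t → (suc i * suc i + t) + (suc i * suc i + t) ≡ 2 * (suc i * suc i) + (t + t)
    regroup = solve-∀
    close : ∀ i → 2 * (suc i * suc i) + suc i * suc (suc i) ≡ suc i * (3 * i + 4)
    close = solve-∀

  TwicePentagonal : ℕ → Set
  TwicePentagonal n = ∃ λ (j : ℤ) → + n ≡ j *ℤ (+ 3 *ℤ j - + 1)

  twice-pentagonal : ∀ k → k ≡ 0 ⊎ (∃ λ i → k ≡ pent⁺ i ⊎ k ≡ pent⁻ i) → TwicePentagonal (k + k)
  twice-pentagonal k (inj₁ refl)           = + 0 , refl
  twice-pentagonal k (inj₂ (i , inj₁ refl)) = + suc i , trans (cong +_ (pent⁺-double i))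
    (trans (pos-* (suc i) (3 * i + 2)) (trans (cong (λ x → + suc i *ℤ (x +ℤ + 2)) (pos-* 3 i)) (poly (+ i))))
    where
    poly : ∀ I → (+ 1 +ℤ I) *ℤ (+ 3 *ℤ I +ℤ + 2) ≡ (+ 1 +ℤ I) *ℤ (+ 3 *ℤ (+ 1 +ℤ I) - + 1)
    poly = ℤ-Solver.solve-∀
  twice-pentagonal k (inj₂ (i , inj₂ refl)) = - (+ suc i) , trans (cong +_ (pent⁻-double i))
    (trans (pos-* (suc i) (3 * i + 4)) (trans (cong (λ x → + suc i *ℤ (x +ℤ + 4)) (pos-* 3 i)) (poly (+ i))))
    where
    poly : ∀ I → (+ 1 +ℤ I) *ℤ (+ 3 *ℤ I +ℤ + 4) ≡ (- (+ 1 +ℤ I)) *ℤ (+ 3 *ℤ (- (+ 1 +ℤ I)) - + 1)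
    poly = ℤ-Solver.solve-∀

  odd-S₁⇒twicePentagonal : ∀ n → odd (S₁ n) ≡ true → TwicePentagonal n
  odd-S₁⇒twicePentagonal n odd-S = subst TwicePentagonal (even⇒⌊n/2⌋+⌊n/2⌋≡n n (proj₁ facts))
    (twice-pentagonal ⌊ n /2⌋ (pentagonalSum-support ⌊ n /2⌋ ⌊ n /2⌋ (proj₂ facts)))
    where
    facts : odd n ≡ false × pentagonalSum ⌊ n /2⌋ ⌊ n /2⌋ ≡ true
    facts = unless-true (odd n) (trans (sym (odd-S₁≡pentagonalSum n)) odd-S)

  even⇒2∣ : ∀ n → odd n ≡ false → 2 ∣ n
  even⇒2∣ zero          _    = divides 0 refl
  even⇒2∣ (suc (suc n)) even with even⇒2∣ n even
  ... | divides q n≡q*2 = divides (suc q) (cong (suc ∘′ suc) n≡q*2)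

open import Data.Integer using (ℤ; +_; _*_; _-_)

corollary4 : (n : ℕ) → ¬ (∃ λ (j : ℤ) → + n ≡ j * (+ 3 * j - + 1)) → 2 ∣ S₁ n
corollary4 n not-twice-pentagonal with odd (S₁ n) in parity
... | false = even⇒2∣ (S₁ n) parity
... | true  = ⊥-elim (not-twice-pentagonal (odd-S₁⇒twicePentagonal n parity))
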